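{- In the all-path convexity, every finite, simple, connected graph $G$ satisfies $gin(G)\leq 1$.
   Context: The all-path interval is $I(S)=S\cup\{v\in V\mid v$ lies on some path of $G$ whose two endpoints are distinct vertices of $S\}$. Set $I^0(S)=S$ and $I^{i+1}(S)=I(I^i(S))$. The geodetic iteration number is $gin(G)=\min\{i\mid I^i(S)=I^{i+1}(S)$ for every $S\subseteq V(G)\}$. -}

module Defs where

open import Data.Nat using (ℕ; zero; suc; _≤_)
open import Data.Fin using (Fin)
open import Data.List using (List; []; _∷_)
open import Data.List.Membership.Propositional using (_∈_)
open import Data.List.Relation.Unary.Unique.Propositional using (Unique)
open import Data.Product using (Σ; ∃; _×_)
open import Data.Sum using (_⊎_)
open import Relation.Binary.PropositionalEquality using (_≡_)
open import Relation.Nullary using (¬_)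

record Graph : Set₁ where
  field
    n     : ℕ
    Adj   : Fin n → Fin n → Set
    sym   : ∀ {u v} → Adj u v → Adj v u
    irrefl : ∀ {u} → ¬ Adj u u

module _ (G : Graph) where
  open Graph G

  data Walk : Fin n → Fin n → List (Fin n) → Set where
    here : ∀ {u} → Walk u u (u ∷ [])
    step : ∀ {u w v vs} → Adj u w → Walk w v vs → Walk u v (u ∷ vs)

  Path : Fin n → Fin n → List (Fin n) → Set
  Path u v vs = Walk u v vs × Unique vs

  Connected : Set
  Connected = ∀ u v → ∃ λ vs → Path u v vs

  VSet : Set₁
  VSet = Fin n → Set

  _≐_ : VSet → VSet → Set
  S ≐ T = ∀ v → (S v → T v) × (T v → S v)

  I : VSet → VSet
  I S v = S v ⊎ Σ (Fin n) λ a → Σ (Fin n) λ b → Σ (List (Fin n)) λ vs →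
            S a × S b × ¬ (a ≡ b) × Path a b vs × v ∈ vs

  Iter : ℕ → VSet → VSet
  Iter zero S = S
  Iter (suc i) S = I (Iter i S)

  Stabilises : ℕ → Set₁
  Stabilises i = ∀ (S : VSet) → Iter i S ≐ Iter (suc i) S

  -- gin(G) ≤ k  (gin is the least i with Stabilises i)
  gin≤ : ℕ → Set₁
  gin≤ k = Σ ℕ λ i → i ≤ k × Stabilises i

-- If v lies on an x–y path L with x, y ∈ I(S), say x on an a–b path Q and y on an
-- a′–b′ path R with a, b, a′, b′ ∈ S, and v is on neither Q nor R, take the maximal
-- subpath c … v … d of L whose inner vertices avoid Q ∪ R. If c and d lie on the same
-- one of Q, R, replacing the part of that path between c and d by this ear gives a path
-- through v between two vertices of S. Otherwise c ∈ Q ∖ R and d ∈ R, say. Follow the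
-- ear from c to d and then R towards b′: either this walk meets Q again, and its part up
-- to there is an ear of Q, or it does not, and Q up to c followed by it is an a–b′ path
-- through v. Hence I(I(S)) = I(S) for every S.

module Submission where

open import Defs
open import Level using (Level)
open import Data.Nat using (s≤s; z≤n)
open import Data.Fin using (Fin; _≟_)
open import Data.List using (List; []; _∷_; _++_; [_]; _∷ʳ_; reverse)
open import Data.List.Properties using (++-assoc; ∷ʳ-++; reverse-++; unfold-reverse)
open import Data.List.Membership.Propositional using (_∈_; _∉_; lose)
open import Data.List.Membership.Propositional.Properties using (∈-++⁺ˡ; ∈-++⁺ʳ; ∈-++⁻; ∈-∃++)
open import Data.List.Relation.Unary.Any using (Any; here; there; any?)
import Data.List.Relation.Unary.Any as Any
import Data.List.Relation.Unary.Any.Properties as Any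
open import Data.List.Relation.Unary.All using (All; []; _∷_)
import Data.List.Relation.Unary.All as All
import Data.List.Relation.Unary.All.Properties as All
open import Data.List.Relation.Unary.AllPairs using ([]; _∷_)
open import Data.List.Relation.Unary.Unique.Propositional using (Unique)
open import Data.List.Relation.Unary.Unique.Propositional.Properties using (++⁺; Unique[x∷xs]⇒x∉xs)
open import Data.List.Relation.Binary.Disjoint.Propositional using (Disjoint)
open import Data.List.Relation.Binary.Subset.Propositional using (_⊆_)
open import Data.List.Relation.Binary.Subset.Propositional.Properties using (xs⊆xs++ys; xs⊆ys++xs; ++⁺ʳ)
open import Data.List.Relation.Binary.Permutation.Propositional using (_↭_; ↭-sym; ↭⇒↭ₛ)
open import Data.List.Relation.Binary.Permutation.Propositional.Properties using (↭-reverse; ++-comm; shifts)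
import Data.List.Relation.Binary.Permutation.Setoid.Properties as ↭ₛ
open import Data.Product using (Σ; ∃; ∃₂; _×_; _,_; -,_; proj₁; proj₂)
open import Data.Sum using (_⊎_; inj₁; inj₂; [_,_]′; fromInj₁)
open import Data.Empty using (⊥-elim)
open import Function using (_∘_)
open import Relation.Nullary using (¬_; yes; no; contradiction)
open import Relation.Unary using (Pred; Decidable; ∁)
open import Relation.Binary.PropositionalEquality using (_≡_; refl; sym; subst; cong; setoid; module ≡-Reasoning)

private
  variable
    a p : Level
    A : Set a

Unique-resp-↭ : {xs ys : List A} → xs ↭ ys → Unique xs → Unique ys
Unique-resp-↭ {A = A} xs↭ys = ↭ₛ.Unique-resp-↭ (setoid A) (↭⇒↭ₛ xs↭ys)

Unique-reverse⁺ : {xs : List A} → Unique xs → Unique (reverse xs)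
Unique-reverse⁺ {xs = xs} = Unique-resp-↭ (↭-sym (↭-reverse xs))

Unique-++⁻ʳ : (xs : List A) {ys : List A} → Unique (xs ++ ys) → Unique ys
Unique-++⁻ʳ []       u       = u
Unique-++⁻ʳ (_ ∷ xs) (_ ∷ u) = Unique-++⁻ʳ xs u

Unique-++⁻ˡ : (xs : List A) {ys : List A} → Unique (xs ++ ys) → Unique xs
Unique-++⁻ˡ xs {ys} u = Unique-++⁻ʳ ys (Unique-resp-↭ (++-comm xs ys) u)

Unique-++⇒Disjoint : (xs : List A) {ys : List A} → Unique (xs ++ ys) → Disjoint xs ys
Unique-++⇒Disjoint (x ∷ xs) (x∉ ∷ _) (here refl , x∈ys) = All.lookup x∉ (∈-++⁺ʳ xs x∈ys) refl
Unique-++⇒Disjoint (x ∷ xs) (_ ∷ u)  (there v∈xs , v∈ys) = Unique-++⇒Disjoint xs u (v∈xs , v∈ys)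

Unique-replace : (xs ms : List A) {zs ys : List A} →
                 Unique (xs ++ ms ++ ys) → Unique zs → Disjoint zs (xs ++ ys) → Unique (xs ++ zs ++ ys)
Unique-replace xs ms {zs} u uzs disj =
  Unique-resp-↭ (shifts zs xs) (++⁺ uzs (Unique-++⁻ʳ ms (Unique-resp-↭ (shifts xs ms) u)) disj)

∈-++⁻-∉ʳ : (xs : List A) {ys : List A} {x : A} → x ∈ xs ++ ys → x ∉ ys → x ∈ xs
∈-++⁻-∉ʳ xs x∈ x∉ys = fromInj₁ (⊥-elim ∘ x∉ys) (∈-++⁻ xs x∈)

x∈xs⇒[x]⊆xs : {x : A} {xs : List A} → x ∈ xs → [ x ] ⊆ xs
x∈xs⇒[x]⊆xs x∈xs (here refl) = x∈xs

reverse-++-∷ : (xs : List A) (x : A) (ys : List A) → reverse (xs ++ x ∷ ys) ≡ reverse ys ++ x ∷ reverse xs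
reverse-++-∷ xs x ys = begin
  reverse (xs ++ x ∷ ys)        ≡⟨ reverse-++ xs (x ∷ ys) ⟩
  reverse (x ∷ ys) ++ reverse xs ≡⟨ cong (_++ reverse xs) (unfold-reverse x ys) ⟩
  reverse ys ∷ʳ x ++ reverse xs  ≡⟨ ∷ʳ-++ (reverse ys) x (reverse xs) ⟩
  reverse ys ++ x ∷ reverse xs   ∎
  where open ≡-Reasoning

module _ {P : Pred A p} (P? : Decidable P) where

  first-split : {xs : List A} → Any P xs →
                ∃₂ λ ys z → ∃ λ zs → xs ≡ ys ++ z ∷ zs × All (∁ P) ys × P z
  first-split {x ∷ xs} Pxs with P? x
  ... | yes Px = [] , x , xs , refl , [] , Px
  ... | no ¬Px with first-split (Any.tail ¬Px Pxs)
  ...   | ys , z , zs , refl , ¬Pys , Pz = x ∷ ys , z , zs , refl , ¬Px ∷ ¬Pys , Pz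

  last-split : {xs : List A} → Any P xs →
               ∃₂ λ ys z → ∃ λ zs → xs ≡ ys ++ z ∷ zs × P z × All (∁ P) zs
  last-split {x ∷ xs} Pxs with any? P? xs
  ... | yes Pxs′ with last-split Pxs′
  ...   | ys , z , zs , refl , Pz , ¬Pzs = x ∷ ys , z , zs , refl , Pz , ¬Pzs
  last-split {x ∷ xs} (here Px)    | no ¬Pxs′ = [] , x , xs , refl , Px , All.¬Any⇒All¬ xs ¬Pxs′
  last-split {x ∷ xs} (there Pxs′) | no ¬Pxs′ = contradiction Pxs′ ¬Pxs′

module _ (G : Graph) where
  open Graph G using (n) renaming (sym to Adj-sym)
  open import Data.List.Membership.DecPropositional (_≟_ {n}) using (_∈?_)

  private
    variable
      u v m x y t c d : Fin n
      B L Q R xs ys zs : List (Fin n)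

  ∈-Walk-head : Walk G u v L → u ∈ L
  ∈-Walk-head here       = here refl
  ∈-Walk-head (step _ _) = here refl

  ∈-Walk-last : Walk G u v L → v ∈ L
  ∈-Walk-last here       = here refl
  ∈-Walk-last (step _ w) = there (∈-Walk-last w)

  Walk-join : Walk G u m xs → Walk G m v (m ∷ ys) → Walk G u v (xs ++ ys)
  Walk-join here       w′ = w′
  Walk-join (step e w) w′ = step e (Walk-join w w′)

  Walk-++ : (xs : List (Fin n)) → Walk G u m (xs ∷ʳ m) → Walk G m v (m ∷ ys) → Walk G u v (xs ++ m ∷ ys)
  Walk-++ {m = m} {ys = ys} xs w₁ w₂ = subst (Walk G _ _) (∷ʳ-++ xs m ys) (Walk-join w₁ w₂)

  Walk-split : (xs : List (Fin n)) → Walk G u v (xs ++ m ∷ ys) → Walk G u m (xs ∷ʳ m) × Walk G m v (m ∷ ys)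
  Walk-split []           here       = here , here
  Walk-split []           (step e w) = here , step e w
  Walk-split (_ ∷ [])     (step e w) with Walk-split [] w
  ... | w₁ , w₂ = step e w₁ , w₂
  Walk-split (_ ∷ x ∷ xs) (step e w) with Walk-split (x ∷ xs) w
  ... | w₁ , w₂ = step e w₁ , w₂

  Walk-reverse : Walk G u v L → Walk G v u (reverse L)
  Walk-reverse here = here
  Walk-reverse {u = u} (step {vs = vs} e w) =
    subst (Walk G _ _) (sym (unfold-reverse u vs)) (Walk-join (Walk-reverse w) (step (Adj-sym e) here))

  Path-split : (xs : List (Fin n)) → Path G u v (xs ++ m ∷ ys) → Path G u m (xs ∷ʳ m) × Path G m v (m ∷ ys)
  Path-split {m = m} {ys = ys} xs (walk , uniq) with Walk-split xs walk
  ... | w₁ , w₂ = (w₁ , Unique-++⁻ˡ (xs ∷ʳ m) (subst Unique (sym (∷ʳ-++ xs m ys)) uniq))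
                , (w₂ , Unique-++⁻ʳ xs uniq)

  Path-++ : (xs : List (Fin n)) → Path G u m (xs ∷ʳ m) → Path G m v (m ∷ ys) → Disjoint xs (m ∷ ys) →
            Path G u v (xs ++ m ∷ ys)
  Path-++ xs (w₁ , uniq₁) (w₂ , uniq₂) disj = Walk-++ xs w₁ w₂ , ++⁺ (Unique-++⁻ˡ xs uniq₁) uniq₂ disj

  Path-reverse : Path G u v L → Path G v u (reverse L)
  Path-reverse (walk , uniq) = Walk-reverse walk , Unique-reverse⁺ uniq

  Path-closed : Path G u u L → v ∈ L → v ≡ u
  Path-closed (here , _)        (here refl) = refl
  Path-closed (step _ w , uniq) _           = ⊥-elim (Unique[x∷xs]⇒x∉xs uniq (∈-Walk-last w))

  PathThrough : Fin n → Fin n → List (Fin n) → Set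
  PathThrough a b zs = ∃ λ L → Path G a b L × zs ⊆ L

  PathThrough-reverse : PathThrough v u zs → PathThrough u v zs
  PathThrough-reverse (L , pL , zs⊆L) = reverse L , Path-reverse pL , Any.reverse⁺ ∘ zs⊆L

  PathThrough-mono : ys ⊆ zs → PathThrough u v zs → PathThrough u v ys
  PathThrough-mono ys⊆zs (L , pL , zs⊆L) = L , pL , zs⊆L ∘ ys⊆zs

  Path-reroute : Walk G u c xs → Path G c d (c ∷ zs ∷ʳ d) → Walk G d v (d ∷ ys) → (ms : List (Fin n)) →
                 Unique (xs ++ ms ++ d ∷ ys) → All (_∉ xs ++ ms ++ d ∷ ys) zs →
                 Path G u v (xs ++ zs ++ d ∷ ys)
  Path-reroute {c = c} {xs = xs} {d = d} {zs = zs} {ys = ys} w₁ (w , uniq) w₂ ms uQ zs∉Q =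
    Walk-join w₁ (Walk-++ (c ∷ zs) w w₂) ,
    Unique-replace xs ms uQ (Unique-++⁻ˡ zs (Unique-++⁻ʳ [ c ] uniq))
      λ (z∈zs , z∈xs++ys) → All.lookup zs∉Q z∈zs (++⁺ʳ xs (xs⊆ys++xs (d ∷ ys) ms) z∈xs++ys)

  Path-graft : (A : List (Fin n)) → Path G u v (A ++ c ∷ B) → Path G c t (c ∷ ys) → All (_∉ A ++ c ∷ B) ys →
               Path G u t (A ++ c ∷ ys)
  Path-graft A pQ pR ys∉Q = Path-++ A (proj₁ (Path-split A pQ)) pR disjoint
    where
    disjoint : Disjoint A (_ ∷ _)
    disjoint (z∈A , here refl)  = Unique-++⇒Disjoint A (proj₂ pQ) (z∈A , here refl)
    disjoint (z∈A , there z∈ys) = All.lookup ys∉Q z∈ys (∈-++⁺ˡ z∈A)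

  ear-ordered : (A : List (Fin n)) → Path G u v (A ++ c ∷ B) → d ∈ B → Path G c d (c ∷ zs ∷ʳ d) →
                All (_∉ A ++ c ∷ B) zs → PathThrough u v zs
  ear-ordered {c = c} {d = d} {zs = zs} A (walk , uQ) d∈B seg zs∉Q with ∈-∃++ d∈B
  ... | M , B′ , refl with Walk-split A walk
  ... | w₁ , w₂ =
    -, Path-reroute w₁ seg (proj₂ (Walk-split (c ∷ M) w₂)) M
                    (subst Unique Q≡ uQ) (subst (λ Q → All (_∉ Q) zs) Q≡ zs∉Q)
     , ∈-++⁺ʳ (A ∷ʳ c) ∘ ∈-++⁺ˡ
    where
    Q≡ : A ++ c ∷ M ++ d ∷ B′ ≡ (A ∷ʳ c) ++ M ++ d ∷ B′
    Q≡ = sym (∷ʳ-++ A c (M ++ d ∷ B′))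

  ear : Path G u v Q → c ∈ Q → d ∈ Q → Path G c d (c ∷ zs ∷ʳ d) → All (_∉ Q) zs → PathThrough u v zs
  ear {zs = zs} pQ c∈Q d∈Q seg zs∉Q with ∈-∃++ c∈Q
  ... | A , B , refl with ∈-++⁻ A d∈Q
  ... | inj₂ (here refl) = ⊥-elim (Unique[x∷xs]⇒x∉xs (proj₂ seg) (∈-++⁺ʳ zs (here refl)))
  ... | inj₂ (there d∈B) = ear-ordered A pQ d∈B seg zs∉Q
  ... | inj₁ d∈A = PathThrough-reverse (ear-ordered (reverse B) pQ′ (Any.reverse⁺ d∈A) seg zs∉Q′)
    where
    rev≡ = reverse-++-∷ A _ B
    pQ′ = subst (Path G _ _) rev≡ (Path-reverse pQ)
    zs∉Q′ = subst (λ Q → All (_∉ Q) zs) rev≡ (All.map (_∘ Any.reverse⁻) zs∉Q)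

  -- Either the path from c re-enters Q, and its part up to the first re-entry is an ear
  -- of Q, or it does not, and Q up to c followed by it is a path from u to t.
  ear-or-extension : Path G u v Q → c ∈ Q → Path G c t (c ∷ zs ++ ys) → All (_∉ Q) zs →
                     PathThrough u v zs ⊎ PathThrough u t zs
  ear-or-extension {Q = Q} {c = c} {zs = zs} {ys = ys} pQ c∈Q pR zs∉Q with any? (_∈? Q) ys
  ... | yes hit with first-split (_∈? Q) hit
  ...   | ys₁ , h , ys₂ , refl , ys₁∉Q , h∈Q =
    inj₁ (PathThrough-mono (xs⊆xs++ys zs ys₁) (ear pQ c∈Q h∈Q seg (All.++⁺ zs∉Q ys₁∉Q)))
    where
    seg = proj₁ (Path-split (c ∷ zs ++ ys₁) (subst (Path G _ _) (cong (c ∷_) (sym (++-assoc zs ys₁ _))) pR))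
  ear-or-extension {zs = zs} {ys = ys} pQ c∈Q pR zs∉Q | no miss with ∈-∃++ c∈Q
  ... | A , B , refl =
    inj₂ (_ , Path-graft A pQ pR (All.++⁺ zs∉Q (All.¬Any⇒All¬ ys miss)) , ∈-++⁺ʳ A ∘ there ∘ ∈-++⁺ˡ)

  bridge : Path G u v Q → Path G x y R → c ∈ Q → c ∉ R → d ∈ R → Path G c d (c ∷ zs ∷ʳ d) →
           All (_∉ Q) zs → All (_∉ R) zs → PathThrough u v zs ⊎ PathThrough u y zs
  bridge {c = c} {d = d} {zs = zs} pQ pR c∈Q c∉R d∈R seg zs∉Q zs∉R with ∈-∃++ d∈R
  ... | A , B , refl = ear-or-extension pQ c∈Q (Path-++ (c ∷ zs) seg (proj₂ (Path-split A pR)) disjoint) zs∉Q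
    where
    disjoint : Disjoint (c ∷ zs) (d ∷ B)
    disjoint (z∈ , z∈dB) = All.lookup (c∉R ∷ zs∉R) z∈ (∈-++⁺ʳ A z∈dB)

  Walk⇒Any-init : {P : Pred (Fin n) p} → Walk G u v (xs ∷ʳ v) → P u → ¬ P v → Any P xs
  Walk⇒Any-init {xs = xs} w Pu ¬Pv with ∈-++⁻ xs (∈-Walk-head w)
  ... | inj₁ u∈xs        = lose u∈xs Pu
  ... | inj₂ (here refl) = contradiction Pu ¬Pv

  Walk⇒Any-tail : {P : Pred (Fin n) p} → Walk G v u (v ∷ xs) → P u → ¬ P v → Any P xs
  Walk⇒Any-tail w Pu ¬Pv with ∈-Walk-last w
  ... | here refl  = contradiction Pu ¬Pv
  ... | there u∈xs = lose u∈xs Pu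

  -- c is the last vertex of K before v on L, and d the first one after v.
  avoiding-segment : (K : List (Fin n)) → Path G x y L → x ∈ K → y ∈ K → v ∈ L → v ∉ K →
                     ∃₂ λ c d → ∃ λ zs → c ∈ K × d ∈ K × Path G c d (c ∷ zs ∷ʳ d) × All (_∉ K) zs × v ∈ zs
  avoiding-segment {v = v} K pL x∈K y∈K v∈L v∉K with ∈-∃++ v∈L
  ... | A , B , refl with Walk-split A (proj₁ pL)
  ... | wA , wB with last-split (_∈? K) (Walk⇒Any-init wA x∈K v∉K)
                   | first-split (_∈? K) (Walk⇒Any-tail wB y∈K v∉K)
  ... | A₁ , c , A₂ , refl , c∈K , A₂∉K | B₁ , d , B₂ , refl , B₁∉K , d∈K =
    c , d , A₂ ++ v ∷ B₁ , c∈K , d∈K , segment , All.++⁺ A₂∉K (v∉K ∷ B₁∉K) , ∈-++⁺ʳ A₂ (here refl)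
    where
    open ≡-Reasoning
    L≡ : (A₁ ++ c ∷ A₂) ++ v ∷ B₁ ++ d ∷ B₂ ≡ A₁ ++ c ∷ (A₂ ++ v ∷ B₁) ++ d ∷ B₂
    L≡ = begin
      (A₁ ++ c ∷ A₂) ++ v ∷ B₁ ++ d ∷ B₂   ≡⟨ ++-assoc A₁ (c ∷ A₂) _ ⟩
      A₁ ++ c ∷ A₂ ++ v ∷ B₁ ++ d ∷ B₂     ≡⟨ cong (λ M → A₁ ++ c ∷ M) (sym (++-assoc A₂ (v ∷ B₁) (d ∷ B₂))) ⟩
      A₁ ++ c ∷ (A₂ ++ v ∷ B₁) ++ d ∷ B₂   ∎
    segment = proj₁ (Path-split (c ∷ A₂ ++ v ∷ B₁) (proj₂ (Path-split A₁ (subst (Path G _ _) L≡ pL))))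

  -- Unlike in I, the endpoints may coincide; by Path-closed this adds only the vertices of S.
  OnPath : VSet G → List (Fin n) → Set
  OnPath S zs = Σ (Fin n) λ a → Σ (Fin n) λ b → S a × S b × PathThrough a b zs

  module _ (S : VSet G) where

    Path⇒OnPath : S u → S v → Path G u v L → x ∈ L → OnPath S [ x ]
    Path⇒OnPath Su Sv pL x∈L = -, -, Su , Sv , -, pL , x∈xs⇒[x]⊆xs x∈L

    I⇒OnPath : I G S v → OnPath S [ v ]
    I⇒OnPath (inj₁ Sv) = Path⇒OnPath Sv Sv (here , [] ∷ []) (here refl)
    I⇒OnPath (inj₂ (_ , _ , _ , Sa , Sb , _ , pL , v∈L)) = Path⇒OnPath Sa Sb pL v∈L

    OnPath⇒I : OnPath S [ v ] → I G S v
    OnPath⇒I (a , b , Sa , Sb , L , pL , v⊆L) with a ≟ b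
    ... | yes refl = inj₁ (subst S (sym (Path-closed pL (v⊆L (here refl)))) Sa)
    ... | no a≢b   = inj₂ (a , b , L , Sa , Sb , a≢b , pL , v⊆L (here refl))

    OnPath-mono : ys ⊆ zs → OnPath S zs → OnPath S ys
    OnPath-mono ys⊆zs (a , b , Sa , Sb , through) = a , b , Sa , Sb , PathThrough-mono ys⊆zs through

    OnPath-segment : S u → S v → Path G u v Q → S x → S y → Path G x y R →
                     c ∈ Q ++ R → d ∈ Q ++ R → Path G c d (c ∷ zs ∷ʳ d) → All (_∉ Q) zs → All (_∉ R) zs →
                     OnPath S zs
    OnPath-segment {Q = Q} {R = R} {c = c} {d = d} Su Sv pQ Sx Sy pR c∈K d∈K seg zs∉Q zs∉R
      with c ∈? R | d ∈? R
    ... | yes c∈R | yes d∈R = -, -, Sx , Sy , ear pR c∈R d∈R seg zs∉R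
    ... | no c∉R  | no d∉R  = -, -, Su , Sv , ear pQ (∈-++⁻-∉ʳ Q c∈K c∉R) (∈-++⁻-∉ʳ Q d∈K d∉R) seg zs∉Q
    ... | no c∉R  | yes d∈R =
      [ (λ path → -, -, Su , Sv , path) , (λ path → -, -, Su , Sy , path) ]′
        (bridge pQ pR (∈-++⁻-∉ʳ Q c∈K c∉R) c∉R d∈R seg zs∉Q zs∉R)
    ... | yes c∈R | no d∉R with c ∈? Q
    ...   | yes c∈Q = -, -, Su , Sv , ear pQ c∈Q (∈-++⁻-∉ʳ Q d∈K d∉R) seg zs∉Q
    ...   | no c∉Q  =
      [ (λ path → -, -, Sx , Sy , path) , (λ path → -, -, Sx , Sv , path) ]′
        (bridge pR pQ c∈R c∉Q (∈-++⁻-∉ʳ Q d∈K d∉R) seg zs∉R zs∉Q)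

    OnPath-path-closed : OnPath S [ x ] → OnPath S [ y ] → Path G x y L → v ∈ L → OnPath S [ v ]
    OnPath-path-closed {v = v} (a , b , Sa , Sb , Q , pQ , x⊆Q) (a′ , b′ , Sa′ , Sb′ , R , pR , y⊆R) pL v∈L
      with v ∈? Q ++ R
    ... | yes v∈K = [ Path⇒OnPath Sa Sb pQ , Path⇒OnPath Sa′ Sb′ pR ]′ (∈-++⁻ Q v∈K)
    ... | no v∉K
      with avoiding-segment (Q ++ R) pL (∈-++⁺ˡ (x⊆Q (here refl))) (∈-++⁺ʳ Q (y⊆R (here refl))) v∈L v∉K
    ...   | c , d , zs , c∈K , d∈K , seg , zs∉K , v∈zs =
      OnPath-mono (x∈xs⇒[x]⊆xs v∈zs)
        (OnPath-segment Sa Sb pQ Sa′ Sb′ pR c∈K d∈K seg (All.map (_∘ ∈-++⁺ˡ) zs∉K) (All.map (_∘ ∈-++⁺ʳ Q) zs∉K))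

    I²⊆I : ∀ v → I G (I G S) v → I G S v
    I²⊆I v (inj₁ v∈IS) = v∈IS
    I²⊆I v (inj₂ (x , y , L , x∈IS , y∈IS , _ , pL , v∈L)) =
      OnPath⇒I (OnPath-path-closed (I⇒OnPath x∈IS) (I⇒OnPath y∈IS) pL v∈L)

corollary3 : (G : Graph) → Connected G → gin≤ G 1
corollary3 G _ = 1 , s≤s z≤n , λ S v → inj₁ , I²⊆I G S v
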